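{- For every integer $n\geq 1$, $\chi_d^t(C(S_{1,n,n}))=n+3$.
   Context: The double star $S_{1,n,n}$ is the graph with vertex set $\{v_0,v_1,\dots,v_{2n}\}$ and edge set $\{v_0v_i,\ v_iv_{n+i} : 1\leq i\leq n\}$. For a graph $G=(V,E)$ with $V=\{v_1,\dots,v_n\}$, the central graph $C(G)$ is the graph with vertex set $V\cup\{c_{ij} : v_iv_j\in E\}$ obtained by subdividing each edge $v_iv_j$ of $G$ exactly once by a new vertex $c_{ij}$ (adjacent to exactly $v_i$ and $v_j$) and joining every pair of distinct vertices non-adjacent in $G$. A total dominator coloring (TDC) of a graph $H$ with no isolated vertices is a proper vertex coloring of $H$ in which every vertex is adjacent to all vertices of some color class. $\chi_d^t(H)$ is the minimum number of color classes in a TDC of $H$. -}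

module Defs where

open import Data.Nat using (ℕ; zero; suc; _+_; _*_; _≤_; _≡ᵇ_; _<ᵇ_)
open import Data.Fin using (Fin; toℕ; _<_)
open import Data.Bool using (Bool; true; false; _∧_; _∨_; not; T)
open import Data.Sum using (_⊎_; inj₁; inj₂)
open import Data.Product using (Σ; ∃; ∃-syntax; _×_; _,_)
open import Data.Empty using (⊥)
open import Relation.Nullary using (¬_)
open import Relation.Binary.PropositionalEquality using (_≡_; _≢_)

-- A (simple) graph on the vertex set Fin m is given by a Bool-valued
-- adjacency function (assumed symmetric and irreflexive; this holds for
-- the double star below).

-- Double star S_{1,n,n}: vertices v_0,...,v_{2n} encoded as Fin (1 + 2n)
-- (v_k ↦ k).  Edges: v_0 v_i and v_i v_{n+i} for 1 ≤ i ≤ n.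
dsEdge : ℕ → ℕ → ℕ → Bool
dsEdge n x y =
  ((x ≡ᵇ 0) ∧ (0 <ᵇ y) ∧ (y <ᵇ suc n))
  ∨ ((0 <ᵇ x) ∧ (x <ᵇ suc n) ∧ (y ≡ᵇ x + n))

doubleStarAdj : (n : ℕ) → Fin (suc (n + n)) → Fin (suc (n + n)) → Bool
doubleStarAdj n a b = dsEdge n (toℕ a) (toℕ b) ∨ dsEdge n (toℕ b) (toℕ a)

-- Vertices: original vertices (inj₁) and one subdivision vertex c_ij for
-- each edge v_i v_j, represented canonically with i < j (inj₂).

CEdge : (m : ℕ) → (Fin m → Fin m → Bool) → Set
CEdge m adj = Σ (Fin m) λ i → Σ (Fin m) λ j → (i < j) × T (adj i j)

CVertex : (m : ℕ) → (Fin m → Fin m → Bool) → Set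
CVertex m adj = Fin m ⊎ CEdge m adj

CAdj : (m : ℕ) → (adj : Fin m → Fin m → Bool) → CVertex m adj → CVertex m adj → Set
CAdj m adj (inj₁ a) (inj₁ b) = (a ≢ b) × ¬ T (adj a b)
CAdj m adj (inj₁ a) (inj₂ (i , j , _)) = (a ≡ i) ⊎ (a ≡ j)
CAdj m adj (inj₂ (i , j , _)) (inj₁ a) = (a ≡ i) ⊎ (a ≡ j)
CAdj m adj (inj₂ _) (inj₂ _) = ⊥

-- Total dominator colorings of a graph with vertex type V and adjacency _~_.
-- A coloring with exactly k color classes is a surjection c : V → Fin k.

record IsTDC {V : Set} (_~_ : V → V → Set) (k : ℕ) (c : V → Fin k) : Set where
  field
    proper     : ∀ u v → u ~ v → c u ≢ c v
    surjective : ∀ (j : Fin k) → ∃[ u ] (c u ≡ j)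
    dominates  : ∀ (v : V) → ∃[ j ] (∀ u → c u ≡ j → v ~ u)

TDCNumberIs : {V : Set} → (V → V → Set) → ℕ → Set
TDCNumberIs {V} _~_ m =
  (∃[ c ] IsTDC _~_ m c) × (∀ (k : ℕ) (c : V → Fin k) → IsTDC _~_ k c → m ≤ k)

module Submission where

-- The hub v₀ together with the outer vertices v_{n+1}, …, v_{2n} is a clique of C(S_{1,n,n}), and so
-- are the inner vertices v₁, …, v_n.  With at most n + 2 colours there is therefore at most one colour
-- besides the n + 1 colours of the first clique, and each inner vertex v_i gets the colour of v₀, the
-- colour of its partner v_{n+i}, or that extra colour.  A subdivision vertex has exactly two
-- neighbours, so the class it dominates lies inside them; this pins down the classes of v₀ and
-- v_{n+i} enough to leave, in every case, either a vertex c_{i,n+i} with no admissible colour or a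
-- vertex (v₀, v_i or v_{n+i}) with a non-neighbour in every colour class.  Conversely, colouring v_i
-- and v_{n+i} with colour i and giving v₀, all c_{0i} and all c_{i,n+i} one new colour each is a total
-- dominator colouring with n + 3 colours.

open import Defs
open import Data.Nat as ℕ using (ℕ; zero; suc; _+_; _≤_; _<_; _≡ᵇ_; _<ᵇ_; z<s; s<s)
import Data.Nat.Properties as ℕ
open import Data.Fin as Fin using (Fin; zero; suc; toℕ; join; splitAt; _≟_)
open import Data.Fin.Properties as Fin using (any?; all?; injective⇒≤)
open import Data.Bool using (T)
open import Data.Bool.Properties using (T-∨; T-∧; T-irrelevant)
open import Data.Sum using (_⊎_; inj₁; inj₂)
open import Data.Sum.Properties using (inj₁-injective; inj₂-injective)
open import Data.Sum.Function.Propositional using (_⊎-⇔_)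
open import Data.Product using (_×_; _,_; proj₁; proj₂; ∃-syntax)
open import Data.Product.Function.NonDependent.Propositional using (_×-⇔_)
open import Data.Empty using (⊥)
open import Function using (_∘_; case_of_)
open import Function.Bundles using (_⇔_; mk⇔; Equivalence)
import Function.Properties.Equivalence as ⇔
open import Function.Related.TypeIsomorphisms using (¬-cong-⇔)
open import Function.Definitions using (Injective)
open import Relation.Nullary using (¬_; yes; no; ¬?; contradiction)
open import Relation.Nullary.Decidable using (decidable-stable)
open import Relation.Unary using (Decidable)
open import Relation.Binary.PropositionalEquality
open import Relation.Binary.Construct.Closure.Symmetric using (SymClosure; fwd; bwd; symmetric)

atMostOneOutside : ∀ {s k} (p : Fin s → Fin k) → Injective _≡_ _≡_ p → k ≤ suc s →
                   ∀ {x y} → (∀ i → x ≢ p i) → (∀ i → y ≢ p i) → x ≡ y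
atMostOneOutside {s} {k} p p-injective k≤1+s {x} {y} x∉p y∉p with x ≟ y
... | yes x≡y = x≡y
... | no x≢y  = contradiction (ℕ.≤-trans (injective⇒≤ extend-injective) k≤1+s) ℕ.1+n≰n
  where
  extend : Fin (suc (suc s)) → Fin k
  extend zero          = x
  extend (suc zero)    = y
  extend (suc (suc i)) = p i

  extend-injective : Injective _≡_ _≡_ extend
  extend-injective {zero}        {zero}        _ = refl
  extend-injective {zero}        {suc zero}    e = contradiction e x≢y
  extend-injective {zero}        {suc (suc j)} e = contradiction e (x∉p j)
  extend-injective {suc zero}    {zero}        e = contradiction (sym e) x≢y
  extend-injective {suc zero}    {suc zero}    _ = refl
  extend-injective {suc zero}    {suc (suc j)} e = contradiction e (y∉p j)
  extend-injective {suc (suc i)} {zero}        e = contradiction (sym e) (x∉p i)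
  extend-injective {suc (suc i)} {suc zero}    e = contradiction (sym e) (y∉p i)
  extend-injective {suc (suc i)} {suc (suc j)} e = cong (λ i → Fin.suc (Fin.suc i)) (p-injective e)

join-injective : ∀ m n {s t} → join m n s ≡ join m n t → s ≡ t
join-injective m n {s} {t} e = begin
  s                      ≡⟨ Fin.splitAt-join m n s ⟨
  splitAt m (join m n s) ≡⟨ cong (splitAt m) e ⟩
  splitAt m (join m n t) ≡⟨ Fin.splitAt-join m n t ⟩
  t                      ∎
  where open ≡-Reasoning

anotherIndex : ∀ {n} (i : Fin n) → (∃[ j ] j ≢ i) ⊎ (∀ j → j ≡ i)
anotherIndex i with any? (λ j → ¬? (j ≟ i))
... | yes found = inj₁ found
... | no none   = inj₂ λ j → decidable-stable (j ≟ i) λ j≢i → none (j , j≢i)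

module TDCProperties {V : Set} {_~_ : V → V → Set} {k : ℕ} {c : V → Fin k}
                     (tdc : IsTDC _~_ k c) where
  open IsTDC tdc

  ~-irrefl : ∀ {u} → ¬ u ~ u
  ~-irrefl {u} u~u = proper u u u~u refl

  clique-injective : ∀ {s} (f : Fin s → V) → (∀ {i j} → i ≢ j → f i ~ f j) →
                     Injective _≡_ _≡_ (c ∘ f)
  clique-injective f clique {i} {j} e with i ≟ j
  ... | yes i≡j = i≡j
  ... | no i≢j  = contradiction e (proper (f i) (f j) (clique i≢j))

  dominatedVertex : ∀ v → ∃[ w ] (∀ u → c u ≡ c w → v ~ u)
  dominatedVertex v with dominates v
  ... | x , d with surjective x
  ...   | w , cw≡x = w , λ u cu≡cw → d u (trans cu≡cw cw≡x)

  cannotDominate : ∀ v → (∀ x → ∃[ u ] (c u ≡ x × ¬ v ~ u)) → ⊥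
  cannotDominate v nonNeighbour with dominates v
  ... | x , d with nonNeighbour x
  ...   | u , cu≡x , v≁u = v≁u (d u cu≡x)

  ClassWithin : V → V → V → Set
  ClassWithin w u₁ u₂ = ∀ u → c u ≡ c w → u ≡ u₁ ⊎ u ≡ u₂

  twoNeighbours : ∀ {v u₁ u₂} → (∀ {u} → v ~ u → u ≡ u₁ ⊎ u ≡ u₂) →
                  ClassWithin u₁ u₁ u₂ ⊎ ClassWithin u₂ u₁ u₂
  twoNeighbours {v} neighbours with dominatedVertex v
  ... | w , d with neighbours (d w refl)
  ...   | inj₁ refl = inj₁ λ u e → neighbours (d u e)
  ...   | inj₂ refl = inj₂ λ u e → neighbours (d u e)

IsTDC-pullback : ∀ {V W : Set} {_~_ : V → V → Set} {_≈_ : W → W → Set} {k c} (g : W → V) →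
                 (∀ v → ∃[ w ] g w ≡ v) → (∀ x y → g x ~ g y ⇔ x ≈ y) →
                 IsTDC _~_ k c → IsTDC _≈_ k (c ∘ g)
IsTDC-pullback {_≈_ = _≈_} {c = c} g g-surjective g-adjacent tdc = record
  { proper     = λ x y x≈y → proper (g x) (g y) (Equivalence.from (g-adjacent x y) x≈y)
  ; surjective = surjective′
  ; dominates  = dominates′
  }
  where
  open IsTDC tdc

  surjective′ : ∀ j → ∃[ x ] c (g x) ≡ j
  surjective′ j with surjective j
  ... | v , cv≡j with g-surjective v
  ...   | x , refl = x , cv≡j

  dominates′ : ∀ x → ∃[ j ] (∀ y → c (g y) ≡ j → x ≈ y)
  dominates′ x with dominates (g x)
  ... | j , d = j , λ y e → Equivalence.to (g-adjacent x y) (d (g y) e)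

TDCNumberIs-transport : ∀ {V W : Set} {_~_ : V → V → Set} {_≈_ : W → W → Set} {m} (g : W → V) →
                        Injective _≡_ _≡_ g → (∀ v → ∃[ w ] g w ≡ v) →
                        (∀ x y → g x ~ g y ⇔ x ≈ y) → TDCNumberIs _≈_ m → TDCNumberIs _~_ m
TDCNumberIs-transport {V} {W} {_~_} {_≈_} g g-injective g-surjective g-adjacent
                      ((c , tdc) , minimal) =
  (c ∘ g⁻¹ , IsTDC-pullback g⁻¹ g⁻¹-surjective g⁻¹-adjacent tdc) ,
  λ k c′ tdc′ → minimal k (c′ ∘ g) (IsTDC-pullback g g-surjective g-adjacent tdc′)
  where
  g⁻¹ : V → W
  g⁻¹ v = proj₁ (g-surjective v)

  g∘g⁻¹ : ∀ v → g (g⁻¹ v) ≡ v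
  g∘g⁻¹ v = proj₂ (g-surjective v)

  g⁻¹-surjective : ∀ x → ∃[ v ] g⁻¹ v ≡ x
  g⁻¹-surjective x = g x , g-injective (g∘g⁻¹ (g x))

  g⁻¹-adjacent : ∀ u v → g⁻¹ u ≈ g⁻¹ v ⇔ u ~ v
  g⁻¹-adjacent u v = subst₂ (λ a b → g⁻¹ u ≈ g⁻¹ v ⇔ a ~ b) (g∘g⁻¹ u) (g∘g⁻¹ v)
                            (⇔.sym (g-adjacent (g⁻¹ u) (g⁻¹ v)))

-- The central graph of the double star

data Node (n : ℕ) : Set where
  hub : Node n
  inner outer : Fin n → Node n

data StarEdge {n : ℕ} : Node n → Node n → Set where
  spoke   : (i : Fin n) → StarEdge hub (inner i)
  pendant : (i : Fin n) → StarEdge (inner i) (outer i)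

StarAdj : ∀ {n} → Node n → Node n → Set
StarAdj {n} = SymClosure (StarEdge {n})

-- node hub, node (inner i), node (outer i) are v₀, v_{i+1}, v_{n+i+1}, and mid e is the vertex
-- subdividing e.  Two nodes are adjacent exactly when they are distinct and not adjacent in the star.
data Vertex (n : ℕ) : Set where
  node : Node n → Vertex n
  mid  : {x y : Node n} → StarEdge x y → Vertex n

data _—_ {n : ℕ} : Vertex n → Vertex n → Set where
  hub—outer   : ∀ {i} → node hub — node (outer i)
  inner—inner : ∀ {i j} → i ≢ j → node (inner i) — node (inner j)
  inner—outer : ∀ {i j} → i ≢ j → node (inner i) — node (outer j)
  outer—outer : ∀ {i j} → i ≢ j → node (outer i) — node (outer j)
  tail—mid    : ∀ {x y : Node n} {e : StarEdge x y} → node x — mid e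
  head—mid    : ∀ {x y : Node n} {e : StarEdge x y} → node y — mid e

_~_ : ∀ {n} → Vertex n → Vertex n → Set
_~_ {n} = SymClosure (_—_ {n})

mid-neighbours : ∀ {n} {x y : Node n} {e : StarEdge x y} {u} →
                 mid e ~ u → u ≡ node x ⊎ u ≡ node y
mid-neighbours (bwd tail—mid) = inj₁ refl
mid-neighbours (bwd head—mid) = inj₂ refl

hubOuterClique : ∀ {n} → Fin (suc n) → Vertex n
hubOuterClique zero    = node hub
hubOuterClique (suc j) = node (outer j)

hubOuterClique-adjacent : ∀ {n} {i j : Fin (suc n)} → i ≢ j → hubOuterClique i ~ hubOuterClique j
hubOuterClique-adjacent {i = zero}  {zero}  0≢0 = contradiction refl 0≢0
hubOuterClique-adjacent {i = zero}  {suc j} _   = fwd hub—outer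
hubOuterClique-adjacent {i = suc i} {zero}  _   = bwd hub—outer
hubOuterClique-adjacent {i = suc i} {suc j} i≢j = fwd (outer—outer (i≢j ∘ cong suc))

-- Lower bound

module LowerBound {n k : ℕ} (c : Vertex (suc n) → Fin k) (tdc : IsTDC _~_ k c)
                  (few : k ≤ suc (suc (suc n))) where
  open IsTDC tdc
  open TDCProperties tdc

  Extra : Fin k → Set
  Extra x = ∀ i → x ≢ c (hubOuterClique i)

  extra? : Decidable Extra
  extra? x = all? λ i → ¬? (x ≟ c (hubOuterClique i))

  extra-unique : ∀ {x y} → Extra x → Extra y → x ≡ y
  extra-unique = atMostOneOutside (c ∘ hubOuterClique)
                   (clique-injective hubOuterClique hubOuterClique-adjacent) few

  colourCases : ∀ x → (∃[ i ] x ≡ c (hubOuterClique i)) ⊎ Extra x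
  colourCases x with any? (λ i → x ≟ c (hubOuterClique i))
  ... | yes found = inj₁ found
  ... | no none   = inj₂ λ i e → none (i , e)

  inner-injective : Injective _≡_ _≡_ (c ∘ node ∘ inner)
  inner-injective = clique-injective (node ∘ inner) (fwd ∘ inner—inner)

  data InnerColour (i : Fin (suc n)) : Set where
    hubColoured   : c (node (inner i)) ≡ c (node hub) → InnerColour i
    outerColoured : c (node (inner i)) ≡ c (node (outer i)) → InnerColour i
    extraColoured : Extra (c (node (inner i))) → InnerColour i

  innerColour : ∀ i → InnerColour i
  innerColour i with colourCases (c (node (inner i)))
  ... | inj₂ extra      = extraColoured extra
  ... | inj₁ (zero , e) = hubColoured e
  ... | inj₁ (suc j , e) with j ≟ i
  ...   | yes refl = outerColoured e
  ...   | no j≢i   = contradiction e (proper _ _ (fwd (inner—outer (j≢i ∘ sym))))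

  endsClass : ∀ {x y} (e : StarEdge x y) → c (node x) ≡ c (node y) →
              ClassWithin (node x) (node x) (node y)
  endsClass e x≡y with twoNeighbours (mid-neighbours {e = e})
  ... | inj₁ xClass = xClass
  ... | inj₂ yClass = λ u cu≡cx → yClass u (trans cu≡cx x≡y)

  hubAlone : ∀ {i} → c (node (inner i)) ≡ c (node (outer i)) →
             ∀ u → c u ≡ c (node hub) → u ≡ node hub
  hubAlone {i} inner≡outer u cu≡hub with twoNeighbours (mid-neighbours {e = spoke i})
  ... | inj₂ innerClass =
        case innerClass (node (outer i)) (sym inner≡outer) of λ { (inj₁ ()) ; (inj₂ ()) }
  ... | inj₁ hubClass with hubClass u cu≡hub
  ...   | inj₁ u≡hub = u≡hub
  ...   | inj₂ refl  = contradiction (trans (sym cu≡hub) inner≡outer) (proper _ _ (fwd hub—outer))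

  outerAlone : ∀ {p} → c (node (inner p)) ≡ c (node hub) →
               ∀ u → c u ≡ c (node (outer p)) → u ≡ node (outer p)
  outerAlone {p} inner≡hub u cu≡outer with twoNeighbours (mid-neighbours {e = pendant p})
  ... | inj₁ innerClass =
        case innerClass (node hub) (sym inner≡hub) of λ { (inj₁ ()) ; (inj₂ ()) }
  ... | inj₂ outerClass with outerClass u cu≡outer
  ...   | inj₁ refl    = contradiction (trans (sym inner≡hub) cu≡outer) (proper _ _ (fwd hub—outer))
  ...   | inj₂ u≡outer = u≡outer

  pendantColour : ∀ {q} → Extra (c (node (inner q))) →
                  c (mid (pendant q)) ≡ c (node hub) ⊎
                  ∃[ j ] (c (mid (pendant q)) ≡ c (node (outer j)) × c (node (inner j)) ≡ c (node hub))
  pendantColour {q} extra with colourCases (c (mid (pendant q)))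
  ... | inj₁ (zero , e) = inj₁ e
  ... | inj₂ extra′     = contradiction (extra-unique extra′ extra) (proper _ _ (bwd tail—mid))
  ... | inj₁ (suc j , e) with innerColour j
  ...   | hubColoured inner≡hub     = inj₂ (j , e , inner≡hub)
  ...   | outerColoured inner≡outer =
          case endsClass (pendant j) inner≡outer _ (trans e (sym inner≡outer))
          of λ { (inj₁ ()) ; (inj₂ ()) }
  ...   | extraColoured extraⱼ with inner-injective (extra-unique extraⱼ extra)
  ...     | refl = contradiction e (proper _ _ (bwd head—mid))

  outerAndExtra⇒⊥ : ∀ {i q} → c (node (inner i)) ≡ c (node (outer i)) →
                    Extra (c (node (inner q))) → ⊥
  outerAndExtra⇒⊥ inner≡outer extra with pendantColour extra
  ... | inj₁ e                    = case hubAlone inner≡outer _ e of λ ()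
  ... | inj₂ (_ , _ , innerⱼ≡hub) = case hubAlone inner≡outer _ innerⱼ≡hub of λ ()

  hubAndExtra⇒⊥ : ∀ {p q} → c (node (inner p)) ≡ c (node hub) →
                  Extra (c (node (inner q))) → ⊥
  hubAndExtra⇒⊥ inner≡hub extra with pendantColour extra
  ... | inj₁ e = case endsClass (spoke _) (sym inner≡hub) _ e of λ { (inj₁ ()) ; (inj₂ ()) }
  ... | inj₂ (j , e , innerⱼ≡hub) with inner-injective (trans innerⱼ≡hub (sym inner≡hub))
  ...   | refl = case outerAlone inner≡hub _ e of λ ()

  outerWithoutExtra⇒⊥ : ∀ {i} → c (node (inner i)) ≡ c (node (outer i)) →
                        (∀ q → ¬ Extra (c (node (inner q)))) → ⊥
  outerWithoutExtra⇒⊥ inner≡outer noExtra = cannotDominate (node hub) nonNeighbour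
    where
    allOuterColoured : ∀ j → c (node (inner j)) ≡ c (node (outer j))
    allOuterColoured j with innerColour j
    ... | hubColoured innerⱼ≡hub       = case hubAlone inner≡outer _ innerⱼ≡hub of λ ()
    ... | outerColoured innerⱼ≡outerⱼ = innerⱼ≡outerⱼ
    ... | extraColoured extra         = contradiction extra (noExtra j)

    pendantExtra : Extra (c (mid (pendant zero)))
    pendantExtra zero    e = case hubAlone inner≡outer _ e of λ ()
    pendantExtra (suc j) e =
      case endsClass (pendant j) (allOuterColoured j) _ (trans e (sym (allOuterColoured j)))
      of λ { (inj₁ ()) ; (inj₂ ()) }

    nonNeighbour : ∀ x → ∃[ u ] (c u ≡ x × ¬ node hub ~ u)
    nonNeighbour x with colourCases x
    ... | inj₁ (zero , e)  = node hub , sym e , ~-irrefl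
    ... | inj₁ (suc j , e) =
          node (inner j) , trans (allOuterColoured j) (sym e) , λ { (fwd ()) ; (bwd ()) }
    ... | inj₂ extra       =
          mid (pendant zero) , extra-unique pendantExtra extra , λ { (fwd ()) ; (bwd ()) }

  hubOnly⇒⊥ : ∀ {p} → c (node (inner p)) ≡ c (node hub) → (∀ q → q ≡ p) → ⊥
  hubOnly⇒⊥ {p} inner≡hub single = cannotDominate (node (outer p)) nonNeighbour
    where
    spokeExtra : Extra (c (mid (spoke p)))
    spokeExtra zero = proper _ _ (bwd tail—mid)
    spokeExtra (suc j) e with single j
    ... | refl = case outerAlone inner≡hub _ e of λ ()

    nonNeighbour : ∀ x → ∃[ u ] (c u ≡ x × ¬ node (outer p) ~ u)
    nonNeighbour x with colourCases x
    ... | inj₁ (zero , e) = node (inner p) , trans inner≡hub (sym e) ,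
                            λ { (fwd ()) ; (bwd (inner—outer p≢p)) → p≢p refl }
    ... | inj₂ extra      = mid (spoke p) , extra-unique spokeExtra extra , λ { (fwd ()) ; (bwd ()) }
    ... | inj₁ (suc j , e) with single j
    ...   | refl = node (outer p) , sym e , ~-irrefl

  extraOnly⇒⊥ : ∀ {q} → Extra (c (node (inner q))) → (∀ j → j ≡ q) → ⊥
  extraOnly⇒⊥ {q} extra single = cannotDominate (node (inner q)) nonNeighbour
    where
    nonNeighbour : ∀ x → ∃[ u ] (c u ≡ x × ¬ node (inner q) ~ u)
    nonNeighbour x with colourCases x
    ... | inj₁ (zero , e) = node hub , sym e , λ { (fwd ()) ; (bwd ()) }
    ... | inj₂ extra′     = node (inner q) , extra-unique extra extra′ , ~-irrefl
    ... | inj₁ (suc j , e) with single j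
    ...   | refl = node (outer q) , sym e , λ { (fwd (inner—outer q≢q)) → q≢q refl ; (bwd ()) }

  noTDC : ⊥
  noTDC with any? (λ i → c (node (inner i)) ≟ c (node (outer i)))
           | any? (λ q → extra? (c (node (inner q))))
           | any? (λ p → c (node (inner p)) ≟ c (node hub))
  ... | yes (_ , inner≡outer) | yes (_ , extra) | _ = outerAndExtra⇒⊥ inner≡outer extra
  ... | yes (_ , inner≡outer) | no noExtra      | _ =
        outerWithoutExtra⇒⊥ inner≡outer λ q extra → noExtra (q , extra)
  ... | no _       | yes (_ , extra) | yes (_ , inner≡hub) = hubAndExtra⇒⊥ inner≡hub extra
  ... | no noOuter | no noExtra      | yes (p , inner≡hub) = hubOnly⇒⊥ inner≡hub onlyP
    where
    onlyP : ∀ q → q ≡ p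
    onlyP q with innerColour q
    ... | hubColoured innerq≡hub     = inner-injective (trans innerq≡hub (sym inner≡hub))
    ... | outerColoured innerq≡outer = contradiction (q , innerq≡outer) noOuter
    ... | extraColoured extra        = contradiction (q , extra) noExtra
  ... | no noOuter | _               | no noHub = extraOnly⇒⊥ (allExtra zero) single
    where
    allExtra : ∀ j → Extra (c (node (inner j)))
    allExtra j with innerColour j
    ... | hubColoured inner≡hub     = contradiction (j , inner≡hub) noHub
    ... | outerColoured inner≡outer = contradiction (j , inner≡outer) noOuter
    ... | extraColoured extra       = extra

    single : ∀ j → j ≡ zero
    single j = inner-injective (extra-unique (allExtra j) (allExtra zero))

lowerBound : ∀ {n k} (c : Vertex (suc n) → Fin k) → IsTDC _~_ k c → suc n + 3 ≤ k
lowerBound {n} {k} c tdc =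
  ℕ.≮⇒≥ λ k<n+4 → LowerBound.noTDC c tdc (subst (k ≤_) (ℕ.+-comm n 3) (ℕ.s≤s⁻¹ k<n+4))

-- Upper bound

module UpperBound {n : ℕ} where

  colour⊎ : Vertex n → Fin n ⊎ Fin 3
  colour⊎ (node hub)        = inj₂ zero
  colour⊎ (node (inner i))  = inj₁ i
  colour⊎ (node (outer i))  = inj₁ i
  colour⊎ (mid (spoke _))   = inj₂ (suc zero)
  colour⊎ (mid (pendant _)) = inj₂ (suc (suc zero))

  —-proper : ∀ {u w} → u — w → colour⊎ u ≢ colour⊎ w
  —-proper hub—outer                  = λ ()
  —-proper (inner—inner i≢j)          = i≢j ∘ inj₁-injective
  —-proper (inner—outer i≢j)          = i≢j ∘ inj₁-injective
  —-proper (outer—outer i≢j)          = i≢j ∘ inj₁-injective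
  —-proper (tail—mid {e = spoke _})   = λ ()
  —-proper (tail—mid {e = pendant _}) = λ ()
  —-proper (head—mid {e = spoke _})   = λ ()
  —-proper (head—mid {e = pendant _}) = λ ()

  colour⊎-proper : ∀ {u w} → u ~ w → colour⊎ u ≢ colour⊎ w
  colour⊎-proper (fwd u—w) = —-proper u—w
  colour⊎-proper (bwd w—u) = —-proper w—u ∘ sym

  hubClass : ∀ {u} → colour⊎ u ≡ inj₂ zero → u ≡ node hub
  hubClass {node hub}         _ = refl
  hubClass {node (inner _)}  ()
  hubClass {node (outer _)}  ()
  hubClass {mid (spoke _)}   ()
  hubClass {mid (pendant _)} ()

  spokeClass : ∀ {u} → colour⊎ u ≡ inj₂ (suc zero) → ∃[ i ] u ≡ mid (spoke i)
  spokeClass {node hub}       ()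
  spokeClass {node (inner _)} ()
  spokeClass {node (outer _)} ()
  spokeClass {mid (spoke i)}   _ = i , refl
  spokeClass {mid (pendant _)} ()

  pairClass : ∀ {u i} → colour⊎ u ≡ inj₁ i → u ≡ node (inner i) ⊎ u ≡ node (outer i)
  pairClass {node hub}         ()
  pairClass {node (inner _)} refl = inj₁ refl
  pairClass {node (outer _)} refl = inj₂ refl
  pairClass {mid (spoke _)}    ()
  pairClass {mid (pendant _)}  ()

  colour⊎-dominates : ∀ v → ∃[ s ] (∀ u → colour⊎ u ≡ s → v ~ u)
  colour⊎-dominates (node hub) =
    inj₂ (suc zero) , λ _ e → case spokeClass e of λ { (_ , refl) → fwd tail—mid }
  colour⊎-dominates (node (outer i)) =
    inj₂ zero , λ _ e → case hubClass e of λ { refl → bwd hub—outer }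
  colour⊎-dominates (mid (spoke i)) =
    inj₂ zero , λ _ e → case hubClass e of λ { refl → bwd tail—mid }
  colour⊎-dominates (mid (pendant i)) =
    inj₁ i , λ _ e → case pairClass e of λ { (inj₁ refl) → bwd tail—mid ; (inj₂ refl) → bwd head—mid }
  colour⊎-dominates (node (inner i)) with anotherIndex i
  ... | inj₁ (j , j≢i) = inj₁ j , λ _ e → case pairClass e of λ
        { (inj₁ refl) → fwd (inner—inner (j≢i ∘ sym)) ; (inj₂ refl) → fwd (inner—outer (j≢i ∘ sym)) }
  ... | inj₂ onlyI = inj₂ (suc zero) , λ _ e → case spokeClass e of λ
        { (j , refl) → case onlyI j of λ { refl → fwd head—mid } }

  colour : Vertex n → Fin (n + 3)
  colour = join n 3 ∘ colour⊎

upperBound : ∀ {n} → IsTDC _~_ (suc n + 3) (UpperBound.colour {suc n})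
upperBound {n} = record
  { proper     = λ _ _ u~w → colour⊎-proper u~w ∘ join-injective (suc n) 3
  ; surjective = surjective
  ; dominates  = dominates
  }
  where
  open UpperBound {suc n}

  colour⊎-surjective : ∀ s → ∃[ u ] colour⊎ u ≡ s
  colour⊎-surjective (inj₁ i)                = node (inner i) , refl
  colour⊎-surjective (inj₂ zero)             = node hub , refl
  colour⊎-surjective (inj₂ (suc zero))       = mid (spoke zero) , refl
  colour⊎-surjective (inj₂ (suc (suc zero))) = mid (pendant zero) , refl

  surjective : ∀ j → ∃[ u ] colour u ≡ j
  surjective j with colour⊎-surjective (splitAt (suc n) j)
  ... | u , e = u , trans (cong (join (suc n) 3) e) (Fin.join-splitAt (suc n) 3 j)

  dominates : ∀ v → ∃[ j ] (∀ u → colour u ≡ j → v ~ u)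
  dominates v with colour⊎-dominates v
  ... | s , d = join (suc n) 3 s , λ u e → d u (join-injective (suc n) 3 e)

-- The Fin encoding of the double star

fromSide : ∀ {n} → Fin n ⊎ Fin n → Node n
fromSide (inj₁ i) = inner i
fromSide (inj₂ i) = outer i

encode : ∀ {n} → Node n → Fin (suc (n + n))
encode     hub       = zero
encode {n} (inner i) = suc (join n n (inj₁ i))
encode {n} (outer i) = suc (join n n (inj₂ i))

decode : ∀ {n} → Fin (suc (n + n)) → Node n
decode     zero    = hub
decode {n} (suc a) = fromSide (splitAt n a)

decode-encode : ∀ {n} (x : Node n) → decode (encode x) ≡ x
decode-encode     hub       = refl
decode-encode {n} (inner i) = cong fromSide (Fin.splitAt-↑ˡ n i n)
decode-encode {n} (outer i) = cong fromSide (Fin.splitAt-↑ʳ n n i)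

encode-decode : ∀ {n} (a : Fin (suc (n + n))) → encode (decode {n} a) ≡ a
encode-decode     zero    = refl
encode-decode {n} (suc a) = trans (encode-fromSide (splitAt n a)) (cong suc (Fin.join-splitAt n n a))
  where
  encode-fromSide : ∀ s → encode (fromSide s) ≡ suc (join n n s)
  encode-fromSide (inj₁ _) = refl
  encode-fromSide (inj₂ _) = refl

encode-injective : ∀ {n} → Injective _≡_ _≡_ (encode {n})
encode-injective {x = x} {y} e = trans (sym (decode-encode x)) (trans (cong decode e) (decode-encode y))

encode-surjective : ∀ {n} (a : Fin (suc (n + n))) → ∃[ x ] encode {n} x ≡ a
encode-surjective a = decode a , encode-decode a

encode≡⇔ : ∀ {n} {x y : Node n} → encode x ≡ encode y ⇔ x ≡ y
encode≡⇔ = mk⇔ encode-injective (cong encode)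

rank : ∀ {n} → Node n → ℕ
rank     hub       = 0
rank     (inner i) = suc (toℕ i)
rank {n} (outer i) = suc (n + toℕ i)

toℕ-encode : ∀ {n} (x : Node n) → toℕ (encode x) ≡ rank x
toℕ-encode     hub       = refl
toℕ-encode {n} (inner i) = cong suc (Fin.toℕ-↑ˡ i n)
toℕ-encode {n} (outer i) = cong suc (Fin.toℕ-↑ʳ n i)

DsEdge : ℕ → ℕ → ℕ → Set
DsEdge n a b = (a ≡ 0 × 0 < b × b < suc n) ⊎ (0 < a × a < suc n × b ≡ a + n)

dsEdge-reflects : ∀ n a b → T (dsEdge n a b) ⇔ DsEdge n a b
dsEdge-reflects n a b =
  ⇔.trans T-∨ (⇔.trans T-∧ (≡ᵇ⇔ ×-⇔ ⇔.trans T-∧ (<ᵇ⇔ ×-⇔ <ᵇ⇔))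
           ⊎-⇔ ⇔.trans T-∧ (<ᵇ⇔ ×-⇔ ⇔.trans T-∧ (<ᵇ⇔ ×-⇔ ≡ᵇ⇔)))
  where
  ≡ᵇ⇔ : ∀ {a b} → T (a ≡ᵇ b) ⇔ a ≡ b
  ≡ᵇ⇔ = mk⇔ (ℕ.≡ᵇ⇒≡ _ _) (ℕ.≡⇒≡ᵇ _ _)

  <ᵇ⇔ : ∀ {a b} → T (a <ᵇ b) ⇔ a < b
  <ᵇ⇔ = mk⇔ (ℕ.<ᵇ⇒< _ _) ℕ.<⇒<ᵇ

DsEdge-rank : ∀ {n} {x y : Node n} → DsEdge n (rank x) (rank y) ⇔ StarEdge x y
DsEdge-rank {n} = mk⇔ to from
  where
  outer≮1+n : ∀ i → ¬ suc (n + toℕ i) < suc n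
  outer≮1+n i n+i<1+n = ℕ.m+n≮m n (toℕ i) (ℕ.s≤s⁻¹ n+i<1+n)

  to : ∀ {x y} → DsEdge n (rank x) (rank y) → StarEdge x y
  to {hub}     {hub}     (inj₁ (_ , () , _))
  to {hub}     {inner j} (inj₁ _)             = spoke j
  to {hub}     {outer j} (inj₁ (_ , _ , j<n)) = contradiction j<n (outer≮1+n j)
  to {hub}               (inj₂ (() , _))
  to {outer i}           (inj₂ (_ , i<n , _)) = contradiction i<n (outer≮1+n i)
  to {inner i} {hub}     (inj₂ (_ , _ , ()))
  to {inner i} {inner j} (inj₂ (_ , _ , e))   =
    contradiction (subst (_< n) (ℕ.suc-injective e) (Fin.toℕ<n j)) (ℕ.m+n≮n (toℕ i) n)
  to {inner i} {outer j} (inj₂ (_ , _ , e))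
    with Fin.toℕ-injective (ℕ.+-cancelˡ-≡ n _ _ (trans (ℕ.suc-injective e) (ℕ.+-comm (toℕ i) n)))
  ... | refl = pendant i

  from : ∀ {x y} → StarEdge x y → DsEdge n (rank x) (rank y)
  from (spoke j)   = inj₁ (refl , z<s , s<s (Fin.toℕ<n j))
  from (pendant i) = inj₂ (z<s , s<s (Fin.toℕ<n i) , cong suc (ℕ.+-comm n (toℕ i)))

doubleStarAdj-encode : ∀ {n} {x y : Node n} →
                       T (doubleStarAdj n (encode x) (encode y)) ⇔ StarAdj x y
doubleStarAdj-encode {n} {x} {y} =
  ⇔.trans T-∨ (⇔.trans (directed x y ⊎-⇔ directed y x) ⊎⇔SymClosure)
  where
  ⊎⇔SymClosure : (StarEdge x y ⊎ StarEdge y x) ⇔ StarAdj x y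
  ⊎⇔SymClosure = mk⇔ (λ { (inj₁ e) → fwd e ; (inj₂ e) → bwd e })
                     (λ { (fwd e) → inj₁ e ; (bwd e) → inj₂ e })

  directed : ∀ x y → T (dsEdge n (toℕ (encode x)) (toℕ (encode y))) ⇔ StarEdge x y
  directed x y rewrite toℕ-encode x | toℕ-encode y = ⇔.trans (dsEdge-reflects n _ _) DsEdge-rank

encode-< : ∀ {n} {x y : Node n} → StarEdge x y → encode x Fin.< encode y
encode-< {n} {x} {y} e = subst₂ _<_ (sym (toℕ-encode x)) (sym (toℕ-encode y)) (rank-< e)
  where
  rank-< : ∀ {x y} → StarEdge x y → rank x < rank y
  rank-< (spoke _)   = z<s
  rank-< (pendant i) = s<s (ℕ.<-≤-trans (Fin.toℕ<n i) (ℕ.m≤m+n n (toℕ i)))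

node~node⇔ : ∀ {n} {x y : Node n} → node x ~ node y ⇔ (x ≢ y × ¬ StarAdj x y)
node~node⇔ {n} = mk⇔ to from
  where
  directed : ∀ {x y : Node n} → node x — node y → x ≢ y × ¬ StarAdj x y
  directed hub—outer         = (λ ()) , λ { (fwd ()) ; (bwd ()) }
  directed (inner—inner i≢j) = (λ { refl → i≢j refl }) , λ { (fwd ()) ; (bwd ()) }
  directed (inner—outer i≢j) = (λ ()) , λ { (fwd (pendant _)) → i≢j refl ; (bwd ()) }
  directed (outer—outer i≢j) = (λ { refl → i≢j refl }) , λ { (fwd ()) ; (bwd ()) }

  to : ∀ {x y : Node n} → node x ~ node y → x ≢ y × ¬ StarAdj x y
  to (fwd x—y) = directed x—y
  to (bwd y—x) with directed y—x
  ... | y≢x , y≁x = y≢x ∘ sym , y≁x ∘ symmetric StarEdge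

  from : ∀ {x y : Node n} → x ≢ y × ¬ StarAdj x y → node x ~ node y
  from {hub}     {hub}     (hub≢hub , _) = contradiction refl hub≢hub
  from {hub}     {inner j} (_ , x≁y)     = contradiction (fwd (spoke j)) x≁y
  from {hub}     {outer j} _             = fwd hub—outer
  from {inner i} {hub}     (_ , x≁y)     = contradiction (bwd (spoke i)) x≁y
  from {inner i} {inner j} (x≢y , _)     = fwd (inner—inner (x≢y ∘ cong inner))
  from {inner i} {outer j} (_ , x≁y) with i ≟ j
  ... | yes refl = contradiction (fwd (pendant i)) x≁y
  ... | no i≢j   = fwd (inner—outer i≢j)
  from {outer i} {hub}     _             = bwd hub—outer
  from {outer i} {inner j} (_ , x≁y) with j ≟ i
  ... | yes refl = contradiction (bwd (pendant j)) x≁y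
  ... | no j≢i   = bwd (inner—outer j≢i)
  from {outer i} {outer j} (x≢y , _)     = fwd (outer—outer (x≢y ∘ cong outer))

node~mid⇔ : ∀ {n} {x y z : Node n} {e : StarEdge x y} → node z ~ mid e ⇔ (z ≡ x ⊎ z ≡ y)
node~mid⇔ = mk⇔ (λ { (fwd tail—mid) → inj₁ refl ; (fwd head—mid) → inj₂ refl })
                (λ { (inj₁ refl) → fwd tail—mid ; (inj₂ refl) → fwd head—mid })

embed : ∀ {n} → Vertex n → CVertex (suc (n + n)) (doubleStarAdj n)
embed (node x)        = inj₁ (encode x)
embed (mid {x} {y} e) =
  inj₂ (encode x , encode y , encode-< e , Equivalence.from doubleStarAdj-encode (fwd e))

embed-adjacent : ∀ {n} (u v : Vertex n) →
                 CAdj (suc (n + n)) (doubleStarAdj n) (embed u) (embed v) ⇔ u ~ v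
embed-adjacent (node x) (node y) =
  ⇔.trans (¬-cong-⇔ encode≡⇔ ×-⇔ ¬-cong-⇔ doubleStarAdj-encode) (⇔.sym node~node⇔)
embed-adjacent (node z) (mid e)  = ⇔.trans (encode≡⇔ ⊎-⇔ encode≡⇔) (⇔.sym node~mid⇔)
embed-adjacent (mid e)  (node z) =
  ⇔.trans (encode≡⇔ ⊎-⇔ encode≡⇔) (⇔.trans (⇔.sym node~mid⇔) (mk⇔ (symmetric _—_) (symmetric _—_)))
embed-adjacent (mid e)  (mid e′) = mk⇔ (λ ()) λ { (fwd ()) ; (bwd ()) }

embed-injective : ∀ {n} → Injective _≡_ _≡_ (embed {n})
embed-injective {_} {node x} {node y} e = cong node (encode-injective (inj₁-injective e))
embed-injective {_} {mid {x} {y} e} {mid {x′} {y′} e′} eq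
  with encode-injective {_} {x} {x′} (cong proj₁ (inj₂-injective eq))
     | encode-injective {_} {y} {y′} (cong (proj₁ ∘ proj₂) (inj₂-injective eq))
... | refl | refl = cong mid (starEdge-irrelevant e e′)
  where
  starEdge-irrelevant : ∀ {x y : Node _} (e e′ : StarEdge x y) → e ≡ e′
  starEdge-irrelevant (spoke _)   (spoke _)   = refl
  starEdge-irrelevant (pendant _) (pendant _) = refl

embed-surjective : ∀ {n} (u : CVertex (suc (n + n)) (doubleStarAdj n)) → ∃[ v ] embed v ≡ u
embed-surjective {n} (inj₁ a) = node (decode a) , cong inj₁ (encode-decode a)
embed-surjective {n} (inj₂ (a , b , a<b , adj)) with encode-surjective {n} a | encode-surjective {n} b
... | x , refl | y , refl with Equivalence.to doubleStarAdj-encode adj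
...   | fwd e = mid e , cong₂ (λ p t → inj₂ (encode x , encode y , p , t))
                              (Fin.<-irrelevant _ _) (T-irrelevant _ _)
...   | bwd e = contradiction a<b (ℕ.<-asym (encode-< e))

proposition5p6 : (n : ℕ) → 1 ≤ n →
    TDCNumberIs (CAdj (suc (n + n)) (doubleStarAdj n)) (n + 3)
proposition5p6 zero ()
proposition5p6 (suc n) _ =
  TDCNumberIs-transport embed embed-injective embed-surjective embed-adjacent
    ((UpperBound.colour , upperBound) , λ _ c tdc → lowerBound c tdc)
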